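{- Let $M=({\mathbb Q}/{\mathbb Z})_+$ be the pointed multiplicative monoid consisting of a base point $*$ (an absorbing element) and elements $e(r)$, $r\in{\mathbb Q}/{\mathbb Z}$, with $e(r)e(s)=e(r+s)$. Let $n\geq 1$ and let ${\rm Mat}_n^R(\overline{\mathbb S})$ be the set of $n\times n$ matrices $\mu=(\mu_{ij})$ with entries in $M$ having at most one entry different from $*$ in each column, made into a pointed monoid by the product $(\mu\mu')_{ik}=\mu_{ij}\mu'_{jk}$ if there is $j$ with $\mu_{ij}\neq *$ and $\mu'_{jk}\neq *$, and $(\mu\mu')_{ik}=*$ otherwise. For $\mu\in{\rm Mat}_n^R(\overline{\mathbb S})$ define the pointed map $\rho(\mu):M\wedge n_+\to M\wedge n_+$ by $\rho(\mu)(\alpha,j)=*$ if $\mu_{ij}=*$ for all $i$, and $\rho(\mu)(\alpha,j)=(\mu_{ij}\alpha,i)$ if $\mu_{ij}\neq *$. Let $\overline{\mathbb S}[n_+]$ be the functor from finite pointed sets to pointed sets $X\mapsto X\wedge M\wedge n_+$, and let ${\rm End}_{\overline{\mathbb S}}(\overline{\mathbb S}[n_+])$ be the monoid (under composition) of natural transformations $\overline{\mathbb S}[n_+]\to\overline{\mathbb S}[n_+]$ whose components commute with the action of $M$ by multiplication on the factor $M$. Then the map \[ \tilde\rho:{\rm Mat}_n^R(\overline{\mathbb S})\to {\rm End}_{\overline{\mathbb S}}(\overline{\mathbb S}[n_+]),\qquad \tilde\rho(\mu)(X)={\rm Id}_X\wedge\rho(\mu), \] is an isomorphism of multiplicative pointed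 monoids.
   Context: $n_+=\{0,1,\dots,n\}$ with base point $0$; $\wedge$ is the smash product of pointed sets. Elements of $M\wedge n_+$ other than the base point are pairs $(\alpha,j)$ with $\alpha\in M\setminus\{*\}$ and $j\in\{1,\dots,n\}$. -}

module Defs where

open import Data.Nat as ℕ using (ℕ)
open import Data.Fin as Fin using (Fin)
open import Data.Fin.Properties using () renaming (_≟_ to _≟ᶠ_)
open import Data.Maybe as Maybe using (Maybe; just; nothing; _<∣>_)
open import Data.Product using (Σ; _×_; _,_)
open import Relation.Nullary using (¬_; yes; no)
open import Relation.Nullary.Decidable using (toWitness)
open import Data.Unit using (tt)
open import Relation.Binary.PropositionalEquality using (_≡_; refl; subst)
open import Data.Rational as ℚ using (ℚ; 0ℚ; 1ℚ; _+_; _-_; -_; _≤_; _<_; _<?_)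
open import Data.Rational.Properties as ℚP using ()

-- ℚ/ℤ, represented by the canonical representative r ∈ ℚ with 0 ≤ r < 1.
-- The proof fields are irrelevant, so two elements are equal iff their
-- representatives are equal.

record QZ : Set where
  constructor qz
  field
    val    : ℚ
    .nonneg : 0ℚ ≤ val
    .lt1    : val < 1ℚ
open QZ public

private
  2ℚ : ℚ
  2ℚ = 1ℚ + 1ℚ

  1-1≡0 : 1ℚ - 1ℚ ≡ 0ℚ
  1-1≡0 = refl

  2-1≡1 : 2ℚ - 1ℚ ≡ 1ℚ
  2-1≡1 = refl

infixl 6 _⊕_
_⊕_ : QZ → QZ → QZ
qz a a≥0 a<1 ⊕ qz b b≥0 b<1 with a + b <? 1ℚ
... | yes s<1 = qz (a + b) (ℚP.+-mono-≤ {0ℚ} {a} {0ℚ} {b} a≥0 b≥0) s<1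
... | no  s≮1 = qz (a + b - 1ℚ)
                    (subst (_≤ a + b - 1ℚ) 1-1≡0
                       (ℚP.+-monoˡ-≤ (- 1ℚ) (ℚP.≮⇒≥ s≮1)))
                    (subst (a + b - 1ℚ <_) 2-1≡1
                       (ℚP.+-monoˡ-< (- 1ℚ) (ℚP.+-mono-< a<1 b<1)))

0QZ : QZ
0QZ = qz 0ℚ (ℚP.≤-refl {0ℚ}) (toWitness {a? = 0ℚ <? 1ℚ} tt)

-- Pointed sets of the form A₊ = A ⊔ {*} are represented as Maybe A
-- (nothing = base point *).  The smash product A₊ ∧ B₊ is (A × B)₊.

_∧₊_ : Set → Set → Set
A ∧₊ B = Maybe (A × B)

smashMap : {A A' B B' : Set} → (Maybe A → Maybe A') → (Maybe B → Maybe B')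
         → A ∧₊ B → A' ∧₊ B'
smashMap f g nothing = nothing
smashMap f g (just (a , b)) with f (just a) | g (just b)
... | just a' | just b' = just (a' , b')
... | _       | _       = nothing

M : Set
M = Maybe QZ

e : QZ → M
e = just

infixl 7 _·_
_·_ : M → M → M
just r · just s = just (r ⊕ s)
_      · _      = nothing

M∧n₊ : ℕ → Set
M∧n₊ n = QZ ∧₊ Fin n

Matrix : ℕ → Set
Matrix n = Fin n → Fin n → M

ColMono : {n : ℕ} → Matrix n → Set
ColMono {n} μ = (j i i' : Fin n) → ¬ (μ i j ≡ nothing) → ¬ (μ i' j ≡ nothing) → i ≡ i'

firstJust : {A : Set} {m : ℕ} → (Fin m → Maybe A) → Maybe A
firstJust {m = ℕ.zero}  f = nothing
firstJust {m = ℕ.suc m} f = f Fin.zero <∣> firstJust (λ j → f (Fin.suc j))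

-- (μ μ')_{ik} = μ_{ij} μ'_{jk} if some j has μ_{ij} ≠ * and μ'_{jk} ≠ *, else *.
-- (Exactly the j's with μ_{ij} μ'_{jk} ≠ * are those; for μ' ∈ Mat_n^R
--  there is at most one such j.)
_⊙_ : {n : ℕ} → Matrix n → Matrix n → Matrix n
(μ ⊙ μ') i k = firstJust (λ j → μ i j · μ' j k)

idMat : {n : ℕ} → Matrix n
idMat i j with i ≟ᶠ j
... | yes _ = e 0QZ
... | no  _ = nothing

zeroMat : {n : ℕ} → Matrix n
zeroMat i j = nothing

ρ : {n : ℕ} → Matrix n → M∧n₊ n → M∧n₊ n
ρ μ nothing        = nothing
ρ μ (just (α , j)) = firstJust (λ i → Maybe.map (λ γ → (γ , i)) (μ i j · e α))

-- Finite pointed sets (skeleton: k₊ = {0,1,…,k}, represented as Maybe (Fin k))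
-- and pointed maps between them.

PtMap : ℕ → ℕ → Set
PtMap k l = Σ (Maybe (Fin k) → Maybe (Fin l)) (λ f → f nothing ≡ nothing)

S[_₊] : ℕ → ℕ → Set
S[ n ₊] k = Fin k ∧₊ (QZ × Fin n)

S[_₊]-map : (n : ℕ) {k l : ℕ} → PtMap k l → S[ n ₊] k → S[ n ₊] l
S[ n ₊]-map (f , _) = smashMap f (λ z → z)

act : {n k : ℕ} → M → S[ n ₊] k → S[ n ₊] k
act β nothing                = nothing
act β (just (x , (α , j)))   = Maybe.map (λ γ → (x , (γ , j))) (β · e α)

Family : ℕ → Set
Family n = (k : ℕ) → S[ n ₊] k → S[ n ₊] k

record IsEnd {n : ℕ} (η : Family n) : Set where
  field
    pointed     : (k : ℕ) → η k nothing ≡ nothing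
    natural     : (k l : ℕ) (f : PtMap k l) (z : S[ n ₊] k) →
                  η l (S[ n ₊]-map f z) ≡ S[ n ₊]-map f (η k z)
    equivariant : (k : ℕ) (β : M) (z : S[ n ₊] k) → η k (act β z) ≡ act β (η k z)

_≈_ : {n : ℕ} → Family n → Family n → Set
η ≈ η' = ∀ k z → η k z ≡ η' k z

_∘ₙ_ : {n : ℕ} → Family n → Family n → Family n
(η ∘ₙ η') k z = η k (η' k z)

idₙ : {n : ℕ} → Family n
idₙ k z = z

*ₙ : {n : ℕ} → Family n
*ₙ k z = nothing

ρ̃ : {n : ℕ} → Matrix n → Family n
ρ̃ μ k = smashMap (λ x → x) (ρ μ)

record ρ̃IsIsomorphism (n : ℕ) : Set where
  field
    ⊙-closed     : (μ μ' : Matrix n) → ColMono μ → ColMono μ' → ColMono (μ ⊙ μ')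
    idMat-mono   : ColMono (idMat {n})
    zeroMat-mono : ColMono (zeroMat {n})
    lands-in-End : (μ : Matrix n) → ColMono μ → IsEnd (ρ̃ μ)
    hom-⊙        : (μ μ' : Matrix n) → ColMono μ → ColMono μ' →
                   ρ̃ (μ ⊙ μ') ≈ (ρ̃ μ ∘ₙ ρ̃ μ')
    hom-id       : ρ̃ (idMat {n}) ≈ idₙ
    hom-*        : ρ̃ (zeroMat {n}) ≈ *ₙ
    injective    : (μ μ' : Matrix n) → ColMono μ → ColMono μ' →
                   ρ̃ μ ≈ ρ̃ μ' → (i j : Fin n) → μ i j ≡ μ' i j
    surjective   : (η : Family n) → IsEnd η →
                   Σ (Matrix n) (λ μ → ColMono μ × (ρ̃ μ ≈ η))

{-# OPTIONS --safe #-}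
-- ℚ/ℤ is a commutative monoid because a ⊕ b is the unique element of [0, 1) that differs
-- from val a + val b by a natural number.  A matrix μ in Mat_n^R has in each column j either
-- no entry or a single entry e(a), in some row i, and then ρ(μ)(α, j) = (a + α, i).  Hence ρ
-- is multiplicative and μ can be read off from the values ρ(μ)(0, j).  Conversely, naturality
-- along the pointed maps 1₊ → k₊ determines an endomorphism η of S̄[n₊] by its component at
-- 1₊, i.e. by a pointed map of M ∧ n₊, and M-equivariance determines that map by the images
-- of the generators (0, j); these images are the columns of a matrix μ with ρ̃(μ) = η.
module Submission where

open import Defs
open import Algebra.Bundles using (CommutativeMonoid)
open CommutativeMonoid using (commutativeSemigroup)
open import Algebra.Structures using (IsCommutativeMonoid)
open import Data.Nat as ℕ using (ℕ; zero; suc; _≥_)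
open import Data.Fin as Fin using (Fin)
open import Data.Fin.Properties using (suc-injective) renaming (_≟_ to _≟ᶠ_)
open import Data.Maybe as Maybe using (Maybe; just; nothing)
open import Data.Maybe.Properties using (map-∘; map-id; just-injective)
open import Data.Product using (∃; ∃₂; _×_; _,_; proj₂; map₂)
open import Data.Sum using (_⊎_; inj₁; inj₂)
open import Data.Empty using (⊥-elim)
open import Function using (id; _∘_)
open import Data.Rational as ℚ using (ℚ; 0ℚ; 1ℚ; _+_; _-_; _≤_; _<_)
open import Data.Rational.Properties as ℚP using ()
open import Relation.Nullary using (yes; no)
open import Relation.Nullary.Decidable using (recompute)
open import Relation.Binary.PropositionalEquality

import Algebra.Properties.CommutativeSemigroup
open import Algebra.Properties.CommutativeSemigroup
  (commutativeSemigroup ℚP.+-0-commutativeMonoid)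
  using (xy∙z≈xz∙y; xy∙z≈yz∙x)
open import Algebra.Properties.Group ℚP.+-0-group using (∙-cancelʳ)

fromℕ : ℕ → ℚ
fromℕ zero    = 0ℚ
fromℕ (suc m) = fromℕ m + 1ℚ

fromℕ-nonNeg : ∀ m → 0ℚ ≤ fromℕ m
fromℕ-nonNeg zero    = ℚP.≤-refl
fromℕ-nonNeg (suc m) = ℚP.+-mono-≤ (fromℕ-nonNeg m) (ℚP.nonNegative⁻¹ 1ℚ)

fromℕ-+ : ∀ m n → fromℕ (m ℕ.+ n) ≡ fromℕ m + fromℕ n
fromℕ-+ zero    n = sym (ℚP.+-identityˡ (fromℕ n))
fromℕ-+ (suc m) n = begin
  fromℕ (m ℕ.+ n) + 1ℚ       ≡⟨ cong (_+ 1ℚ) (fromℕ-+ m n) ⟩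
  (fromℕ m + fromℕ n) + 1ℚ   ≡⟨ xy∙z≈xz∙y (fromℕ m) (fromℕ n) 1ℚ ⟩
  (fromℕ m + 1ℚ) + fromℕ n   ∎
  where open ≡-Reasoning

+-fromℕ-suc-≢ : ∀ {p q} m → p < 1ℚ → 0ℚ ≤ q → p + 0ℚ ≢ q + fromℕ (suc m)
+-fromℕ-suc-≢ {p} {q} m p<1 0≤q eq = ℚP.<-irrefl refl (begin-strict
  1ℚ                     ≡⟨ sym (ℚP.+-identityˡ 1ℚ) ⟩
  0ℚ + 1ℚ                ≤⟨ ℚP.+-monoˡ-≤ 1ℚ (ℚP.+-mono-≤ 0≤q (fromℕ-nonNeg m)) ⟩
  (q + fromℕ m) + 1ℚ     ≡⟨ ℚP.+-assoc q (fromℕ m) 1ℚ ⟩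
  q + fromℕ (suc m)      ≡⟨ sym eq ⟩
  p + 0ℚ                 ≡⟨ ℚP.+-identityʳ p ⟩
  p                      <⟨ p<1 ⟩
  1ℚ                     ∎)
  where open ℚP.≤-Reasoning

+-fromℕ-injectiveˡ : ∀ {p q} m n → 0ℚ ≤ p → p < 1ℚ → 0ℚ ≤ q → q < 1ℚ →
                     p + fromℕ m ≡ q + fromℕ n → p ≡ q
+-fromℕ-injectiveˡ {p} {q} zero zero _ _ _ _ eq =
  trans (sym (ℚP.+-identityʳ p)) (trans eq (ℚP.+-identityʳ q))
+-fromℕ-injectiveˡ zero (suc n) _ p<1 0≤q _ eq =
  ⊥-elim (+-fromℕ-suc-≢ n p<1 0≤q eq)
+-fromℕ-injectiveˡ (suc m) zero 0≤p _ _ q<1 eq =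
  ⊥-elim (+-fromℕ-suc-≢ m q<1 0≤p (sym eq))
+-fromℕ-injectiveˡ {p} {q} (suc m) (suc n) 0≤p p<1 0≤q q<1 eq =
  +-fromℕ-injectiveˡ m n 0≤p p<1 0≤q q<1 (∙-cancelʳ 1ℚ (p + fromℕ m) (q + fromℕ n) eq′)
  where
  open ≡-Reasoning
  eq′ : (p + fromℕ m) + 1ℚ ≡ (q + fromℕ n) + 1ℚ
  eq′ = begin
    (p + fromℕ m) + 1ℚ   ≡⟨ ℚP.+-assoc p (fromℕ m) 1ℚ ⟩
    p + fromℕ (suc m)    ≡⟨ eq ⟩
    q + fromℕ (suc n)    ≡⟨ sym (ℚP.+-assoc q (fromℕ n) 1ℚ) ⟩
    (q + fromℕ n) + 1ℚ   ∎

_Represents_ : QZ → ℚ → Set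
a Represents p = ∃ λ m → val a + fromℕ m ≡ p

val-Represents : ∀ a → a Represents val a
val-Represents a = 0 , ℚP.+-identityʳ (val a)

Represents-unique : ∀ {a b p} → a Represents p → b Represents p → a ≡ b
Represents-unique {qz p 0≤p p<1} {qz q 0≤q q<1} (m , eq) (n , eq′)
  with +-fromℕ-injectiveˡ m n
         (recompute (0ℚ ℚP.≤? p) 0≤p) (recompute (p ℚ.<? 1ℚ) p<1)
         (recompute (0ℚ ℚP.≤? q) 0≤q) (recompute (q ℚ.<? 1ℚ) q<1)
         (trans eq (sym eq′))
... | refl = refl

⊕-Represents : ∀ a b → (a ⊕ b) Represents (val a + val b)
⊕-Represents (qz p _ _) (qz q _ _) with p + q ℚ.<? 1ℚ
... | yes _ = 0 , ℚP.+-identityʳ (p + q)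
... | no  _ = 1 , trans (cong ((p + q - 1ℚ) +_) (ℚP.+-identityˡ 1ℚ)) (begin
  (p + q - 1ℚ) + 1ℚ         ≡⟨ ℚP.+-assoc (p + q) (ℚ.- 1ℚ) 1ℚ ⟩
  (p + q) + (ℚ.- 1ℚ + 1ℚ)   ≡⟨ cong ((p + q) +_) (ℚP.+-inverseˡ 1ℚ) ⟩
  (p + q) + 0ℚ              ≡⟨ ℚP.+-identityʳ (p + q) ⟩
  p + q                     ∎)
  where open ≡-Reasoning

Represents-⊕ʳ : ∀ {p} a c → a Represents p → (a ⊕ c) Represents (p + val c)
Represents-⊕ʳ {p} a c (m , eq) with ⊕-Represents a c
... | (n , eq′) = n ℕ.+ m , (begin
  val (a ⊕ c) + fromℕ (n ℕ.+ m)         ≡⟨ cong (val (a ⊕ c) +_) (fromℕ-+ n m) ⟩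
  val (a ⊕ c) + (fromℕ n + fromℕ m)
    ≡⟨ sym (ℚP.+-assoc (val (a ⊕ c)) (fromℕ n) (fromℕ m)) ⟩
  (val (a ⊕ c) + fromℕ n) + fromℕ m     ≡⟨ cong (_+ fromℕ m) eq′ ⟩
  (val a + val c) + fromℕ m             ≡⟨ xy∙z≈xz∙y (val a) (val c) (fromℕ m) ⟩
  (val a + fromℕ m) + val c             ≡⟨ cong (_+ val c) eq ⟩
  p + val c                             ∎)
  where open ≡-Reasoning

⊕-comm : ∀ a b → a ⊕ b ≡ b ⊕ a
⊕-comm a b = Represents-unique (⊕-Represents a b)
  (subst ((b ⊕ a) Represents_) (ℚP.+-comm (val b) (val a)) (⊕-Represents b a))

⊕-assoc : ∀ a b c → (a ⊕ b) ⊕ c ≡ a ⊕ (b ⊕ c)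
⊕-assoc a b c = trans (Represents-unique abc bca) (⊕-comm (b ⊕ c) a)
  where
  abc : ((a ⊕ b) ⊕ c) Represents ((val b + val c) + val a)
  abc = subst (((a ⊕ b) ⊕ c) Represents_) (xy∙z≈yz∙x (val a) (val b) (val c))
          (Represents-⊕ʳ (a ⊕ b) c (⊕-Represents a b))
  bca : ((b ⊕ c) ⊕ a) Represents ((val b + val c) + val a)
  bca = Represents-⊕ʳ (b ⊕ c) a (⊕-Represents b c)

⊕-identityˡ : ∀ a → 0QZ ⊕ a ≡ a
⊕-identityˡ a = Represents-unique
  (subst ((0QZ ⊕ a) Represents_) (ℚP.+-identityˡ (val a)) (⊕-Represents 0QZ a))
  (val-Represents a)

⊕-identityʳ : ∀ a → a ⊕ 0QZ ≡ a
⊕-identityʳ a = trans (⊕-comm a 0QZ) (⊕-identityˡ a)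

⊕-0-isCommutativeMonoid : IsCommutativeMonoid _≡_ _⊕_ 0QZ
⊕-0-isCommutativeMonoid = record
  { isMonoid = record
    { isSemigroup = record
      { isMagma = record { isEquivalence = isEquivalence ; ∙-cong = cong₂ _⊕_ }
      ; assoc   = ⊕-assoc }
    ; identity = ⊕-identityˡ , ⊕-identityʳ }
  ; comm = ⊕-comm }

⊕-0-commutativeMonoid : CommutativeMonoid _ _
⊕-0-commutativeMonoid = record { isCommutativeMonoid = ⊕-0-isCommutativeMonoid }

module ⊕-Properties =
  Algebra.Properties.CommutativeSemigroup (commutativeSemigroup ⊕-0-commutativeMonoid)

just≢nothing : ∀ {A : Set} {x : Maybe A} {a : A} → x ≡ just a → x ≢ nothing
just≢nothing refl ()

module _ {A : Set} where

  nothing-or-just : ∀ {m} (f : Fin m → Maybe A) →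
                    (∀ i → f i ≡ nothing) ⊎ ∃₂ λ i a → f i ≡ just a
  nothing-or-just {zero}  f = inj₁ λ ()
  nothing-or-just {suc m} f with f Fin.zero in f0 | nothing-or-just (f ∘ Fin.suc)
  ... | just a  | _                 = inj₂ (Fin.zero , a , f0)
  ... | nothing | inj₂ (i , a , fi) = inj₂ (Fin.suc i , a , fi)
  ... | nothing | inj₁ none         = inj₁ λ { Fin.zero → f0 ; (Fin.suc i) → none i }

  firstJust-nothing : ∀ {m} (f : Fin m → Maybe A) → (∀ i → f i ≡ nothing) →
                      firstJust f ≡ nothing
  firstJust-nothing {zero}  f none = refl
  firstJust-nothing {suc m} f none rewrite none Fin.zero =
    firstJust-nothing (f ∘ Fin.suc) (none ∘ Fin.suc)

  firstJust-unique : ∀ {m} (f : Fin m → Maybe A) (i : Fin m) →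
                     (∀ i′ → i′ ≢ i → f i′ ≡ nothing) → firstJust f ≡ f i
  firstJust-unique {suc m} f Fin.zero others
    rewrite firstJust-nothing (f ∘ Fin.suc) (λ i′ → others (Fin.suc i′) λ ())
    with f Fin.zero
  ... | just _  = refl
  ... | nothing = refl
  firstJust-unique {suc m} f (Fin.suc i) others rewrite others Fin.zero (λ ()) =
    firstJust-unique (f ∘ Fin.suc) i λ i′ i′≢i → others (Fin.suc i′) (i′≢i ∘ suc-injective)

  firstJust-cong : ∀ {m} {f g : Fin m → Maybe A} → f ≗ g → firstJust f ≡ firstJust g
  firstJust-cong {zero}  f≗g = refl
  firstJust-cong {suc m} f≗g =
    cong₂ Maybe._<∣>_ (f≗g Fin.zero) (firstJust-cong (f≗g ∘ Fin.suc))

  firstJust-≢nothing : ∀ {m} (f : Fin m → Maybe A) → firstJust f ≢ nothing →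
                       ∃ λ i → f i ≢ nothing
  firstJust-≢nothing f first≢* with nothing-or-just f
  ... | inj₁ none          = ⊥-elim (first≢* (firstJust-nothing f none))
  ... | inj₂ (i , a , fi) = i , just≢nothing fi

module _ {A A′ B B′ : Set} where

  smashMap-cong : {f : Maybe A → Maybe A′} {g g′ : Maybe B → Maybe B′} →
                  g ≗ g′ → smashMap f g ≗ smashMap f g′
  smashMap-cong         g≗g′ nothing        = refl
  smashMap-cong {g = g} g≗g′ (just (x , y)) rewrite g≗g′ (just y) = refl

  smashMap-fuseˡ : (f : Maybe A → Maybe A′) (g : Maybe B → Maybe B′) →
                   smashMap id g ∘ smashMap f id ≗ smashMap f g
  smashMap-fuseˡ f g nothing = refl
  smashMap-fuseˡ f g (just (x , y)) with f (just x)
  ... | nothing = refl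
  ... | just _ with g (just y)
  ...   | just _  = refl
  ...   | nothing = refl

  smashMap-fuseʳ : (f : Maybe A → Maybe A′) (g : Maybe B → Maybe B′) →
                   smashMap f id ∘ smashMap id g ≗ smashMap f g
  smashMap-fuseʳ f g nothing = refl
  smashMap-fuseʳ f g (just (x , y)) with g (just y)
  ... | just _ with f (just x)
  ...   | just _  = refl
  ...   | nothing = refl
  smashMap-fuseʳ f g (just (x , y)) | nothing with f (just x)
  ...   | just _  = refl
  ...   | nothing = refl

module _ {X B : Set} where

  smashMap-idˡ : (g : Maybe B → Maybe B) (x : X) (y : B) →
                 smashMap id g (just (x , y)) ≡ Maybe.map (x ,_) (g (just y))
  smashMap-idˡ g x y with g (just y)
  ... | just _  = refl
  ... | nothing = refl

  smashMap-id-∘ : (g h : Maybe B → Maybe B) → g nothing ≡ nothing →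
                  smashMap {X} id g ∘ smashMap id h ≗ smashMap id (g ∘ h)
  smashMap-id-∘ g h g* nothing = refl
  smashMap-id-∘ g h g* (just (x , y)) with h (just y)
  ... | just y′ = refl
  ... | nothing rewrite g* = refl

shift : {n : ℕ} → QZ → QZ × Fin n → QZ × Fin n
shift β (α , j) = (β ⊕ α , j)

·-assoc : ∀ (x y z : M) → (x · y) · z ≡ x · (y · z)
·-assoc (just a) (just b) (just c) = cong just (⊕-assoc a b c)
·-assoc (just a) (just b) nothing  = refl
·-assoc (just a) nothing  z        = refl
·-assoc nothing  y        z        = refl

·-zeroʳ : ∀ (x : M) → x · nothing ≡ nothing
·-zeroʳ (just _) = refl
·-zeroʳ nothing  = refl

·-≢nothingˡ : ∀ (x y : M) → x · y ≢ nothing → x ≢ nothing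
·-≢nothingˡ x y xy≢* refl = xy≢* refl

·-≢nothingʳ : ∀ (x y : M) → x · y ≢ nothing → y ≢ nothing
·-≢nothingʳ x y xy≢* refl = xy≢* (·-zeroʳ x)

act-nothing : ∀ {n k} (z : S[ n ₊] k) → act nothing z ≡ nothing
act-nothing nothing  = refl
act-nothing (just _) = refl

act-just : ∀ {n k} β (z : S[ n ₊] k) → act (just β) z ≡ Maybe.map (map₂ (shift β)) z
act-just β nothing  = refl
act-just β (just _) = refl

data Column {n : ℕ} (μ : Matrix n) (j : Fin n) : Set where
  empty  : (∀ i → μ i j ≡ nothing) → Column μ j
  single : ∀ i a → μ i j ≡ just a → (∀ i′ → i′ ≢ i → μ i′ j ≡ nothing) → Column μ j

column : ∀ {n} {μ : Matrix n} → ColMono μ → ∀ j → Column μ j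
column {μ = μ} mono j with nothing-or-just (λ i → μ i j)
... | inj₁ none          = empty none
... | inj₂ (i , a , μij) = single i a μij others
  where
  others : ∀ i′ → i′ ≢ i → μ i′ j ≡ nothing
  others i′ i′≢i with μ i′ j in μi′j
  ... | nothing = refl
  ... | just b  = ⊥-elim (i′≢i (mono j i′ i (just≢nothing μi′j) (just≢nothing μij)))

module _ {n : ℕ} (μ : Matrix n) {j : Fin n} (α : QZ) where

  ρ-empty : (∀ i → μ i j ≡ nothing) → ρ μ (just (α , j)) ≡ nothing
  ρ-empty none = firstJust-nothing _ λ i → cong (λ x → Maybe.map (_, i) (x · e α)) (none i)

  ρ-single : ∀ {i a} → μ i j ≡ just a → (∀ i′ → i′ ≢ i → μ i′ j ≡ nothing) →
             ρ μ (just (α , j)) ≡ just (a ⊕ α , i)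
  ρ-single {i} μij others = trans
    (firstJust-unique _ i λ i′ i′≢i →
       cong (λ x → Maybe.map (_, i′) (x · e α)) (others i′ i′≢i))
    (cong (λ x → Maybe.map (_, i) (x · e α)) μij)

ρ-shift : ∀ {n} {μ : Matrix n} → ColMono μ → ∀ β α j →
          ρ μ (just (β ⊕ α , j)) ≡ Maybe.map (shift β) (ρ μ (just (α , j)))
ρ-shift {μ = μ} mono β α j with column mono j
... | empty none =
  trans (ρ-empty μ (β ⊕ α) none) (cong (Maybe.map (shift β)) (sym (ρ-empty μ α none)))
... | single i a μij others
  rewrite ρ-single μ (β ⊕ α) μij others | ρ-single μ α μij others =
  cong (λ γ → just (γ , i)) (⊕-Properties.x∙yz≈y∙xz a β α)

columnOf : ∀ {n} → M∧n₊ n → Fin n → M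
columnOf nothing        i = nothing
columnOf (just (γ , i₀)) i with i ≟ᶠ i₀
... | yes _ = e γ
... | no  _ = nothing

module _ {n : ℕ} {γ : QZ} {i₀ : Fin n} where

  columnOf-diagonal : columnOf (just (γ , i₀)) i₀ ≡ e γ
  columnOf-diagonal with i₀ ≟ᶠ i₀
  ... | yes _    = refl
  ... | no i₀≢i₀ = ⊥-elim (i₀≢i₀ refl)

  columnOf-off : ∀ i → i ≢ i₀ → columnOf (just (γ , i₀)) i ≡ nothing
  columnOf-off i i≢i₀ with i ≟ᶠ i₀
  ... | yes i≡i₀ = ⊥-elim (i≢i₀ i≡i₀)
  ... | no _     = refl

columnOf-≢nothing : ∀ {n} (w : M∧n₊ n) {i} → columnOf w i ≢ nothing →
                    ∃ λ γ → w ≡ just (γ , i)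
columnOf-≢nothing nothing                ≢* = ⊥-elim (≢* refl)
columnOf-≢nothing (just (γ , i₀)) {i} ≢* with i ≟ᶠ i₀
... | yes refl = γ , refl
... | no _     = ⊥-elim (≢* refl)

fromColumns : ∀ {n} → (Fin n → M∧n₊ n) → Matrix n
fromColumns c i j = columnOf (c j) i

fromColumns-colMono : ∀ {n} (c : Fin n → M∧n₊ n) → ColMono (fromColumns c)
fromColumns-colMono c j i i′ ≢* ≢*′
  with columnOf-≢nothing (c j) ≢* | columnOf-≢nothing (c j) ≢*′
... | _ , cj≡γi | _ , cj≡γ′i′ = cong proj₂ (just-injective (trans (sym cj≡γi) cj≡γ′i′))

ρ-column : ∀ {n} (μ : Matrix n) {j} (w : M∧n₊ n) → (∀ i → μ i j ≡ columnOf w i) →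
           ∀ α → ρ μ (just (α , j)) ≡ Maybe.map (shift α) w
ρ-column μ nothing         μ≡w α = ρ-empty μ α μ≡w
ρ-column μ (just (γ , i₀)) μ≡w α = trans
  (ρ-single μ α (trans (μ≡w i₀) columnOf-diagonal)
     λ i i≢i₀ → trans (μ≡w i) (columnOf-off i i≢i₀))
  (cong (λ δ → just (δ , i₀)) (⊕-comm γ α))

fromColumns-ρ : ∀ {n} {μ : Matrix n} → ColMono μ →
                ∀ i j → fromColumns (λ j → ρ μ (just (0QZ , j))) i j ≡ μ i j
fromColumns-ρ {μ = μ} mono i j with column mono j
... | empty none rewrite ρ-empty μ 0QZ none = sym (none i)
... | single i₀ a μi₀j others rewrite ρ-single μ 0QZ μi₀j others with i ≟ᶠ i₀
...   | yes refl = trans (cong just (⊕-identityʳ a)) (sym μi₀j)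
...   | no i≢i₀  = sym (others i i≢i₀)

idMat-column : ∀ {n} (i j : Fin n) → idMat i j ≡ columnOf (just (0QZ , j)) i
idMat-column i j with i ≟ᶠ j
... | yes _ = refl
... | no  _ = refl

idMat-colMono : ∀ {n} → ColMono (idMat {n})
idMat-colMono j i i′ ≢* ≢*′ = fromColumns-colMono (λ j → just (0QZ , j)) j i i′
  (≢* ∘ trans (idMat-column i j)) (≢*′ ∘ trans (idMat-column i′ j))

ρ-idMat : ∀ {n} → ρ (idMat {n}) ≗ id
ρ-idMat nothing        = refl
ρ-idMat (just (α , j)) = trans (ρ-column idMat (just (0QZ , j)) (λ i → idMat-column i j) α)
                               (cong (λ γ → just (γ , j)) (⊕-identityʳ α))

module _ {n : ℕ} (μ μ′ : Matrix n) where

  ⊙-column-empty : ∀ {k} → (∀ j → μ′ j k ≡ nothing) → ∀ i → (μ ⊙ μ′) i k ≡ nothing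
  ⊙-column-empty none i =
    firstJust-nothing _ λ j → trans (cong (μ i j ·_) (none j)) (·-zeroʳ (μ i j))

  ⊙-column-single : ∀ {j k b} → μ′ j k ≡ just b → (∀ j′ → j′ ≢ j → μ′ j′ k ≡ nothing) →
                    ∀ i → (μ ⊙ μ′) i k ≡ μ i j · e b
  ⊙-column-single {j} μ′jk others i = trans
    (firstJust-unique _ j λ j′ j′≢j →
       trans (cong (μ i j′ ·_) (others j′ j′≢j)) (·-zeroʳ (μ i j′)))
    (cong (μ i j ·_) μ′jk)

  ⊙-colMono : ColMono μ → ColMono μ′ → ColMono (μ ⊙ μ′)
  ⊙-colMono mono mono′ k i i′ μμ′ik≢* μμ′i′k≢*
    with firstJust-≢nothing _ μμ′ik≢* | firstJust-≢nothing _ μμ′i′k≢*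
  ... | j , ≢* | j′ , ≢*′
    with mono′ k j j′ (·-≢nothingʳ (μ i j) (μ′ j k) ≢*) (·-≢nothingʳ (μ i′ j′) (μ′ j′ k) ≢*′)
  ... | refl =
    mono j i i′ (·-≢nothingˡ (μ i j) (μ′ j k) ≢*) (·-≢nothingˡ (μ i′ j) (μ′ j k) ≢*′)

  ρ-⊙ : ColMono μ′ → ρ (μ ⊙ μ′) ≗ ρ μ ∘ ρ μ′
  ρ-⊙ mono′ nothing = refl
  ρ-⊙ mono′ (just (α , k)) with column mono′ k
  ... | empty none rewrite ρ-empty μ′ α none = ρ-empty (μ ⊙ μ′) α (⊙-column-empty none)
  ... | single j b μ′jk others rewrite ρ-single μ′ α μ′jk others =
    firstJust-cong λ i → cong (Maybe.map (_, i)) (begin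
      (μ ⊙ μ′) i k · e α     ≡⟨ cong (_· e α) (⊙-column-single μ′jk others i) ⟩
      (μ i j · e b) · e α    ≡⟨ ·-assoc (μ i j) (e b) (e α) ⟩
      μ i j · e (b ⊕ α)      ∎)
    where open ≡-Reasoning

ρ̃-IsEnd : ∀ {n} {μ : Matrix n} → ColMono μ → IsEnd (ρ̃ μ)
ρ̃-IsEnd {n} {μ} mono = record
  { pointed     = λ k → refl
  ; natural     = λ { k l (f , _) z →
                      trans (smashMap-fuseˡ f (ρ μ) z) (sym (smashMap-fuseʳ f (ρ μ) z)) }
  ; equivariant = equivariant
  }
  where
  equivariant : ∀ k β (z : S[ n ₊] k) → ρ̃ μ k (act β z) ≡ act β (ρ̃ μ k z)
  equivariant k nothing  z rewrite act-nothing z | act-nothing (ρ̃ μ k z) = refl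
  equivariant k (just β) nothing = refl
  equivariant k (just β) (just (x , (α , j))) = begin
    smashMap id (ρ μ) (just (x , (β ⊕ α , j)))
      ≡⟨ smashMap-idˡ (ρ μ) x (β ⊕ α , j) ⟩
    Maybe.map (x ,_) (ρ μ (just (β ⊕ α , j)))
      ≡⟨ cong (Maybe.map (x ,_)) (ρ-shift mono β α j) ⟩
    Maybe.map (x ,_) (Maybe.map (shift β) w)
      ≡⟨ sym (map-∘ w) ⟩
    Maybe.map (λ y → (x , shift β y)) w
      ≡⟨ map-∘ w ⟩
    Maybe.map (map₂ (shift β)) (Maybe.map (x ,_) w)
      ≡⟨ cong (Maybe.map (map₂ (shift β))) (sym (smashMap-idˡ (ρ μ) x (α , j))) ⟩
    Maybe.map (map₂ (shift β)) (ρ̃ μ k (just (x , (α , j))))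
      ≡⟨ sym (act-just β (ρ̃ μ k (just (x , (α , j))))) ⟩
    act (just β) (ρ̃ μ k (just (x , (α , j))))
      ∎
    where open ≡-Reasoning
          w = ρ μ (just (α , j))

ρ̃-⊙ : ∀ {n} (μ μ′ : Matrix n) → ColMono μ′ → ρ̃ (μ ⊙ μ′) ≈ (ρ̃ μ ∘ₙ ρ̃ μ′)
ρ̃-⊙ μ μ′ mono′ k z =
  trans (smashMap-cong (ρ-⊙ μ μ′ mono′) z) (sym (smashMap-id-∘ (ρ μ) (ρ μ′) refl z))

ρ̃-idMat : ∀ {n} → ρ̃ (idMat {n}) ≈ idₙ
ρ̃-idMat k nothing        = refl
ρ̃-idMat k (just (x , y)) =
  trans (smashMap-idˡ (ρ idMat) x y) (cong (Maybe.map (x ,_)) (ρ-idMat (just y)))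

ρ̃-zeroMat : ∀ {n} → ρ̃ (zeroMat {n}) ≈ *ₙ
ρ̃-zeroMat k nothing              = refl
ρ̃-zeroMat k (just (x , (α , j))) =
  trans (smashMap-idˡ (ρ zeroMat) x (α , j))
        (cong (Maybe.map (x ,_)) (ρ-empty zeroMat {j} α λ _ → refl))

underlying : ∀ {n} → Family n → QZ × Fin n → M∧n₊ n
underlying η y = Maybe.map proj₂ (η 1 (just (Fin.zero , y)))

underlying-ρ̃ : ∀ {n} (μ : Matrix n) y → underlying (ρ̃ μ) y ≡ ρ μ (just y)
underlying-ρ̃ μ y = begin
  Maybe.map proj₂ (smashMap id (ρ μ) (just (Fin.zero , y)))
    ≡⟨ cong (Maybe.map proj₂) (smashMap-idˡ (ρ μ) Fin.zero y) ⟩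
  Maybe.map proj₂ (Maybe.map (Fin.zero ,_) (ρ μ (just y)))
    ≡⟨ sym (map-∘ (ρ μ (just y))) ⟩
  Maybe.map id (ρ μ (just y))
    ≡⟨ map-id (ρ μ (just y)) ⟩
  ρ μ (just y)
    ∎
  where open ≡-Reasoning

ρ̃-injective : ∀ {n} {μ μ′ : Matrix n} → ColMono μ → ColMono μ′ →
              ρ̃ μ ≈ ρ̃ μ′ → ∀ i j → μ i j ≡ μ′ i j
ρ̃-injective {μ = μ} {μ′} mono mono′ ρ̃μ≈ρ̃μ′ i j = begin
  μ i j                                ≡⟨ sym (fromColumns-ρ mono i j) ⟩
  columnOf (ρ μ (just (0QZ , j))) i    ≡⟨ cong (λ w → columnOf w i) ρμ≡ρμ′ ⟩
  columnOf (ρ μ′ (just (0QZ , j))) i   ≡⟨ fromColumns-ρ mono′ i j ⟩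
  μ′ i j                               ∎
  where
  open ≡-Reasoning
  ρμ≡ρμ′ : ρ μ (just (0QZ , j)) ≡ ρ μ′ (just (0QZ , j))
  ρμ≡ρμ′ = begin
    ρ μ (just (0QZ , j))      ≡⟨ sym (underlying-ρ̃ μ (0QZ , j)) ⟩
    underlying (ρ̃ μ) (0QZ , j)
      ≡⟨ cong (Maybe.map proj₂) (ρ̃μ≈ρ̃μ′ 1 (just (Fin.zero , (0QZ , j)))) ⟩
    underlying (ρ̃ μ′) (0QZ , j) ≡⟨ underlying-ρ̃ μ′ (0QZ , j) ⟩
    ρ μ′ (just (0QZ , j))     ∎

module _ {n : ℕ} {η : Family n} (η-End : IsEnd η) where
  open IsEnd η-End

  select : ∀ {k} → Fin k → PtMap 1 k
  select x = (λ { nothing → nothing ; (just _) → just x }) , refl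

  IsEnd-underlying : ∀ k x y → η k (just (x , y)) ≡ Maybe.map (x ,_) (underlying η y)
  IsEnd-underlying k x y =
    trans (natural 1 k (select x) (just (Fin.zero , y))) (select-smash (η 1 (just (Fin.zero , y))))
    where
    select-smash : ∀ w → S[ n ₊]-map (select x) w ≡ Maybe.map (x ,_) (Maybe.map proj₂ w)
    select-smash nothing               = refl
    select-smash (just (Fin.zero , _)) = refl

  underlying-shift : ∀ α j → underlying η (α , j) ≡ Maybe.map (shift α) (underlying η (0QZ , j))
  underlying-shift α j = begin
    Maybe.map proj₂ (η 1 (just (Fin.zero , (α , j))))
      ≡⟨ cong (λ β → Maybe.map proj₂ (η 1 (just (Fin.zero , (β , j))))) (sym (⊕-identityʳ α)) ⟩
    Maybe.map proj₂ (η 1 (act (just α) (just (Fin.zero , (0QZ , j)))))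
      ≡⟨ cong (Maybe.map proj₂) (equivariant 1 (just α) (just (Fin.zero , (0QZ , j)))) ⟩
    Maybe.map proj₂ (act (just α) w)
      ≡⟨ cong (Maybe.map proj₂) (act-just α w) ⟩
    Maybe.map proj₂ (Maybe.map (map₂ (shift α)) w)
      ≡⟨ sym (map-∘ w) ⟩
    Maybe.map (shift α ∘ proj₂) w
      ≡⟨ map-∘ w ⟩
    Maybe.map (shift α) (Maybe.map proj₂ w)
      ∎
    where open ≡-Reasoning
          w = η 1 (just (Fin.zero , (0QZ , j)))

  matrixOf : Matrix n
  matrixOf = fromColumns λ j → underlying η (0QZ , j)

  matrixOf-colMono : ColMono matrixOf
  matrixOf-colMono = fromColumns-colMono λ j → underlying η (0QZ , j)

  ρ̃-matrixOf : ρ̃ matrixOf ≈ η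
  ρ̃-matrixOf k nothing              = sym (pointed k)
  ρ̃-matrixOf k (just (x , (α , j))) = begin
    smashMap id (ρ matrixOf) (just (x , (α , j)))
      ≡⟨ smashMap-idˡ (ρ matrixOf) x (α , j) ⟩
    Maybe.map (x ,_) (ρ matrixOf (just (α , j)))
      ≡⟨ cong (Maybe.map (x ,_)) (ρ-column matrixOf (underlying η (0QZ , j)) (λ i → refl) α) ⟩
    Maybe.map (x ,_) (Maybe.map (shift α) (underlying η (0QZ , j)))
      ≡⟨ cong (Maybe.map (x ,_)) (sym (underlying-shift α j)) ⟩
    Maybe.map (x ,_) (underlying η (α , j))
      ≡⟨ sym (IsEnd-underlying k x (α , j)) ⟩
    η k (just (x , (α , j)))
      ∎
    where open ≡-Reasoning

proposition2p4 : (n : ℕ) → n ≥ 1 → ρ̃IsIsomorphism n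
proposition2p4 n _ = record
  { ⊙-closed     = ⊙-colMono
  ; idMat-mono   = idMat-colMono
  ; zeroMat-mono = λ _ _ _ ≢* _ → ⊥-elim (≢* refl)
  ; lands-in-End = λ _ → ρ̃-IsEnd
  ; hom-⊙        = λ μ μ′ _ mono′ → ρ̃-⊙ μ μ′ mono′
  ; hom-id       = ρ̃-idMat
  ; hom-*        = ρ̃-zeroMat
  ; injective    = λ _ _ → ρ̃-injective
  ; surjective   = λ η η-End → matrixOf η-End , matrixOf-colMono η-End , ρ̃-matrixOf η-End
  }
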